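{- Let $\lambda=(\lambda_1,\lambda_2,\lambda_3)$ be a partition with $\lambda_1\ge\lambda_2\ge\lambda_3>0$ and $A=\mathcal{L}(\lambda)$. (1) If $\lambda_1=\lambda_2=\lambda_3$, then $\mathbb{SG}(A)=0$ if $\lambda_3\ge3$ is odd; $\mathbb{SG}(A)=1$ if $\lambda_3=1$ or $\lambda_3\ge4$ is even; $\mathbb{SG}(A)=2$ if $\lambda_3=2$. (2) If $\lambda_1>\lambda_2=\lambda_3$, then $\mathbb{SG}(A)=0$ if $\lambda_3$ is odd and $1$ if $\lambda_3$ is even. (3) If $\lambda_1=\lambda_2>\lambda_3$, then $\mathbb{SG}(A)=0$ if $\lambda_3$ is even and $1$ if $\lambda_3$ is odd. (4) If $\lambda_1>\lambda_2>\lambda_3=1$, then $\mathbb{SG}(A)=1$ if $\lambda_2$ is even and $2$ if $\lambda_2$ is odd. (5) If $\lambda_1>\lambda_2>\lambda_3>1$, then $\mathbb{SG}(A)=0$ if $\lambda_3$ is even and $1$ if $\lambda_3$ is odd.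
   Context: For a partition $\mu=(\mu_1,\dots,\mu_s)$ and nonnegative integers $i,j$, $\mu[i,j]$ is $(\mu_{i+1}-j,\mu_{i+2}-j,\dots)$ with nonpositive entries removed, if $i<s$ and $j<\mu_{i+1}$; otherwise $\mu[i,j]=()$. LCTR $\mathcal{L}(\lambda)$: impartial normal-play game on partitions; from a nonempty $\mu$ one moves to $\mu[1,0]$ or $\mu[0,1]$; $()$ is terminal. $\mathbb{SG}$ is the Sprague--Grundy value, $\mathbb{SG}(A)=\operatorname{mex}\{\mathbb{SG}(B):A\to B\}$. -}

module Defs where

open import Data.Nat using (ℕ; zero; suc; _+_; _∸_; _<?_; _≟_)
open import Data.Nat.Divisibility using (_∣_)
open import Data.List using (List; []; _∷_; drop; map; filter; length)
open import Data.Nat.ListAction using (sum)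
open import Data.Bool using (Bool; true; false; if_then_else_)
open import Relation.Nullary using (¬_; does)

-- μ[i,j] : drop the first i rows, subtract j from each remaining entry,
-- remove nonpositive entries; () if i ≥ s or j ≥ μ_{i+1}.
shift : List ℕ → ℕ → ℕ → List ℕ
shift μ i j with drop i μ
... | [] = []
... | x ∷ xs = if does (j <? x) then filter (λ y → 0 <? y) (map (_∸ j) (x ∷ xs)) else []

elem : ℕ → List ℕ → Bool
elem n [] = false
elem n (x ∷ xs) = if does (n ≟ x) then true else elem n xs

mexSearch : ℕ → ℕ → List ℕ → ℕ
mexSearch zero start l = start
mexSearch (suc k) start l = if elem start l then mexSearch k (suc start) l else start

mex : List ℕ → ℕ
mex l = mexSearch (suc (length l)) 0 l

-- Sprague–Grundy value of LCTR position μ, with explicit fuel.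
-- From nonempty μ the options are μ[1,0] and μ[0,1]; () is terminal.
sgFuel : ℕ → List ℕ → ℕ
sgFuel _ [] = 0
sgFuel zero (_ ∷ _) = 0
sgFuel (suc k) (x ∷ xs) =
  mex (sgFuel k (shift (x ∷ xs) 1 0) ∷ sgFuel k (shift (x ∷ xs) 0 1) ∷ [])

-- Fuel length μ + sum μ suffices: every move strictly decreases length + sum.
SG : List ℕ → ℕ
SG μ = sgFuel (length μ + sum μ) μ

-- the game L(λ) is identified with its starting position λ
L : List ℕ → List ℕ
L λ′ = λ′

Even : ℕ → Set
Even n = 2 ∣ n

Odd : ℕ → Set
Odd n = ¬ Even n

module Submission where

-- Every move strictly decreases (number of rows + number of cells), so the fuelled
-- computation in SG stabilises and SG obeys the recursion
-- SG μ = mex {SG μ[1,0], SG μ[0,1]}.  Removing the top row of (l, m, n) leaves (m, n),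
-- and removing the left column leaves (l - 1, m - 1, n - 1) with zero rows dropped.
-- Hence the values of the one-, two- and three-row positions follow by induction on
-- the smallest row, each step being the mex of two already known values that depend
-- only on a parity.

open import Defs
open import Data.Nat using (ℕ; zero; suc; _+_; _*_; _∸_; _≤_; _<_; _>_; _≥_; z≤n; s≤s; s≤s⁻¹; z<s; _<?_)
open import Data.Nat.Properties
open import Data.Nat.ListAction using (sum)
open import Data.Nat.Divisibility using (divides; ∣-refl; ∣m∣n⇒∣m+n)
open import Data.List using (List; []; _∷_; length; map; filter; drop)
open import Data.List.Properties using (length-filter; length-map)
open import Data.Bool using (Bool; true; false; not; if_then_else_)
open import Data.Bool.Properties using (not-involutive; ¬-not)
open import Data.Product using (_×_; _,_; proj₁; proj₂; swap)
open import Data.Sum using (_⊎_; inj₁; inj₂)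
open import Relation.Nullary using (does)
open import Relation.Unary using (Pred; Decidable)
open import Relation.Binary.PropositionalEquality using (_≡_; refl; sym; trans; cong; cong₂)

size : List ℕ → ℕ
size μ = length μ + sum μ

sum-filter : ∀ {p} {P : Pred ℕ p} (P? : Decidable P) xs → sum (filter P? xs) ≤ sum xs
sum-filter P? [] = z≤n
sum-filter P? (x ∷ xs) with does (P? x)
... | true  = +-monoʳ-≤ x (sum-filter P? xs)
... | false = ≤-trans (sum-filter P? xs) (m≤n+m (sum xs) x)

sum-map-∸ : ∀ j xs → sum (map (_∸ j) xs) ≤ sum xs
sum-map-∸ j [] = z≤n
sum-map-∸ j (x ∷ xs) = +-mono-≤ (m∸n≤m x j) (sum-map-∸ j xs)

size-filter : ∀ {p} {P : Pred ℕ p} (P? : Decidable P) xs → size (filter P? xs) ≤ size xs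
size-filter P? xs = +-mono-≤ (length-filter P? xs) (sum-filter P? xs)

size-map-∸ : ∀ j xs → size (map (_∸ j) xs) ≤ size xs
size-map-∸ j xs = +-mono-≤ (≤-reflexive (length-map (_∸ j) xs)) (sum-map-∸ j xs)

size-shift : ∀ μ i j → size (shift μ i j) ≤ size (map (_∸ j) (drop i μ))
size-shift μ i j with drop i μ
... | [] = z≤n
... | x ∷ xs with does (j <? x)
...   | true  = size-filter (0 <?_) (map (_∸ j) (x ∷ xs))
...   | false = z≤n

removeTopRow removeLeftColumn : List ℕ → List ℕ
removeTopRow μ = shift μ 1 0
removeLeftColumn μ = shift μ 0 1

size-removeTopRow : ∀ x xs → size (removeTopRow (x ∷ xs)) < size (x ∷ xs)
size-removeTopRow x xs = s≤s (begin
  size (removeTopRow (x ∷ xs))   ≤⟨ size-shift (x ∷ xs) 1 0 ⟩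
  size (map (_∸ 0) xs)           ≤⟨ size-map-∸ 0 xs ⟩
  length xs + sum xs             ≤⟨ +-monoʳ-≤ (length xs) (m≤n+m (sum xs) x) ⟩
  length xs + (x + sum xs)       ∎)
  where open ≤-Reasoning

size-removeLeftColumn : ∀ x xs → size (removeLeftColumn (x ∷ xs)) < size (x ∷ xs)
size-removeLeftColumn zero    xs = s≤s z≤n
size-removeLeftColumn (suc x) xs = ≤-<-trans (size-shift (suc x ∷ xs) 0 1)
  (+-mono-≤-< (≤-reflexive (cong suc (length-map (_∸ 1) xs)))
              (s≤s (+-monoʳ-≤ x (sum-map-∸ 1 xs))))

mex₂ : ℕ → ℕ → ℕ
mex₂ u v = mex (u ∷ v ∷ [])

sgFuel-stable : ∀ μ {k k′} → size μ ≤ k → size μ ≤ k′ → sgFuel k μ ≡ sgFuel k′ μ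
sgFuel-stable []       _     _      = refl
sgFuel-stable (x ∷ xs) {suc k} {suc k′} μ≤k μ≤k′ =
  cong₂ mex₂ (stable (removeTopRow (x ∷ xs)) (size-removeTopRow x xs))
             (stable (removeLeftColumn (x ∷ xs)) (size-removeLeftColumn x xs))
  where
  stable : ∀ ν → size ν < size (x ∷ xs) → sgFuel k ν ≡ sgFuel k′ ν
  stable ν ν<μ =
    sgFuel-stable ν (s≤s⁻¹ (<-≤-trans ν<μ μ≤k)) (s≤s⁻¹ (<-≤-trans ν<μ μ≤k′))

SG-mex : ∀ x xs →
         SG (x ∷ xs) ≡ mex₂ (SG (removeTopRow (x ∷ xs))) (SG (removeLeftColumn (x ∷ xs)))
SG-mex x xs = cong₂ mex₂ (enough (removeTopRow (x ∷ xs)) (size-removeTopRow x xs))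
                         (enough (removeLeftColumn (x ∷ xs)) (size-removeLeftColumn x xs))
  where
  enough : ∀ ν → size ν < size (x ∷ xs) → sgFuel (length xs + (x + sum xs)) ν ≡ SG ν
  enough ν ν<μ = sgFuel-stable ν (s≤s⁻¹ ν<μ) ≤-refl

SG-moves : ∀ x xs {u v} →
           SG (removeTopRow (x ∷ xs)) ≡ u → SG (removeLeftColumn (x ∷ xs)) ≡ v →
           SG (x ∷ xs) ≡ mex₂ u v
SG-moves x xs top left = trans (SG-mex x xs) (cong₂ mex₂ top left)

even : ℕ → Bool
even zero    = true
even (suc n) = not (even n)

even-*2 : ∀ q → even (q * 2) ≡ true
even-*2 zero    = refl
even-*2 (suc q) = trans (not-involutive (even (q * 2))) (even-*2 q)

Even⇒even≡true : ∀ {n} → Even n → even n ≡ true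
Even⇒even≡true (divides q refl) = even-*2 q

even≡true⇒Even : ∀ n → even n ≡ true → Even n
even≡true⇒Even zero          _ = divides 0 refl
even≡true⇒Even (suc zero)     ()
even≡true⇒Even (suc (suc n)) e =
  ∣m∣n⇒∣m+n (∣-refl {2}) (even≡true⇒Even n (trans (sym (not-involutive (even n))) e))

Odd⇒even≡false : ∀ {n} → Odd n → even n ≡ false
Odd⇒even≡false {n} odd = ¬-not {y = true} (λ e → odd (even≡true⇒Even n e))

parity-cases : ∀ {n a b x : ℕ} → x ≡ (if even n then a else b) →
               (Even n → x ≡ a) × (Odd n → x ≡ b)
parity-cases {n} {a} {b} x≡ =
    (λ e → trans x≡ (cong (λ c → if c then a else b) (Even⇒even≡true e)))
  , (λ o → trans x≡ (cong (λ c → if c then a else b) (Odd⇒even≡false o)))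

-- In each step below both branches are the same term: mex₂ only computes once the
-- parity is fixed.
SG-[n] : ∀ {n} → 0 < n → SG (n ∷ []) ≡ (if even n then 2 else 1)
SG-[n] {1} _ = refl
SG-[n] {suc (suc n)} _ with even n | SG-[n] {1 + n} z<s
... | true  | left = SG-moves (2 + n) [] refl left
... | false | left = SG-moves (2 + n) [] refl left

SG-[n,n] : ∀ {n} → 0 < n → SG (n ∷ n ∷ []) ≡ (if even n then 0 else 2)
SG-[n,n] {1} _ = refl
SG-[n,n] {suc (suc n)} _ with even n | SG-[n] {2 + n} z<s | SG-[n,n] {1 + n} z<s
... | true  | top | left = SG-moves (2 + n) (2 + n ∷ []) top left
... | false | top | left = SG-moves (2 + n) (2 + n ∷ []) top left

SG-[m,n] : ∀ {m n} → 0 < n → n < m → SG (m ∷ n ∷ []) ≡ (if even n then 1 else 0)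
SG-[m,n] {1} {1} _ (s≤s ())
SG-[m,n] {suc (suc m)} {1} _ _ with even m | SG-[n] {1 + m} z<s
... | true  | left = SG-moves (2 + m) (1 ∷ []) refl left
... | false | left = SG-moves (2 + m) (1 ∷ []) refl left
SG-[m,n] {suc (suc m)} {suc (suc n)} _ (s≤s n<m)
  with even n | SG-[n] {2 + n} z<s | SG-[m,n] {1 + m} {1 + n} z<s n<m
... | true  | top | left = SG-moves (2 + m) (2 + n ∷ []) top left
... | false | top | left = SG-moves (2 + m) (2 + n ∷ []) top left

SG-[n,n,n] : ∀ {n} → 3 ≤ n → SG (n ∷ n ∷ n ∷ []) ≡ (if even n then 1 else 0)
SG-[n,n,n] {1} (s≤s ())
SG-[n,n,n] {2} (s≤s (s≤s ()))
SG-[n,n,n] {3} _ = refl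
SG-[n,n,n] {suc (suc (suc (suc n)))} _
  with even n | SG-[n,n] {4 + n} z<s | SG-[n,n,n] {3 + n} (m≤m+n 3 n)
... | true  | top | left = SG-moves (4 + n) (4 + n ∷ 4 + n ∷ []) top left
... | false | top | left = SG-moves (4 + n) (4 + n ∷ 4 + n ∷ []) top left

SG-[m,n,n] : ∀ {m n} → 0 < n → n < m → SG (m ∷ n ∷ n ∷ []) ≡ (if even n then 1 else 0)
SG-[m,n,n] {1} {1} _ (s≤s ())
SG-[m,n,n] {suc (suc m)} {1} _ _ with even m | SG-[n] {1 + m} z<s
... | true  | left = SG-moves (2 + m) (1 ∷ 1 ∷ []) refl left
... | false | left = SG-moves (2 + m) (1 ∷ 1 ∷ []) refl left
SG-[m,n,n] {suc (suc m)} {suc (suc n)} _ (s≤s n<m)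
  with even n | SG-[n,n] {2 + n} z<s | SG-[m,n,n] {1 + m} {1 + n} z<s n<m
... | true  | top | left = SG-moves (2 + m) (2 + n ∷ 2 + n ∷ []) top left
... | false | top | left = SG-moves (2 + m) (2 + n ∷ 2 + n ∷ []) top left

SG-[m,m,n] : ∀ {m n} → 0 < n → n < m → SG (m ∷ m ∷ n ∷ []) ≡ (if even n then 0 else 1)
SG-[m,m,n] {1} {1} _ (s≤s ())
SG-[m,m,n] {suc (suc m)} {1} _ 1<m with even m | SG-[m,n] z<s 1<m | SG-[n,n] {1 + m} z<s
... | true  | top | left = SG-moves (2 + m) (2 + m ∷ 1 ∷ []) top left
... | false | top | left = SG-moves (2 + m) (2 + m ∷ 1 ∷ []) top left
SG-[m,m,n] {suc (suc m)} {suc (suc n)} _ n<m@(s≤s n<m′)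
  with even n | SG-[m,n] z<s n<m | SG-[m,m,n] {1 + m} {1 + n} z<s n<m′
... | true  | top | left = SG-moves (2 + m) (2 + m ∷ 2 + n ∷ []) top left
... | false | top | left = SG-moves (2 + m) (2 + m ∷ 2 + n ∷ []) top left

SG-[l,m,1] : ∀ {l m} → 1 < m → m < l → SG (l ∷ m ∷ 1 ∷ []) ≡ (if even m then 1 else 2)
SG-[l,m,1] {m = 1} (s≤s ()) _
SG-[l,m,1] {suc (suc l)} {suc (suc m)} _ (s≤s m<l)
  with even m | SG-[m,n] {2 + m} {1} z<s (s≤s (s≤s z≤n)) | SG-[m,n] {1 + l} {1 + m} z<s m<l
... | true  | top | left = SG-moves (2 + l) (2 + m ∷ 1 ∷ []) top left
... | false | top | left = SG-moves (2 + l) (2 + m ∷ 1 ∷ []) top left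

SG-[l,m,n] : ∀ {l m n} → 1 < n → n < m → m < l →
             SG (l ∷ m ∷ n ∷ []) ≡ (if even n then 0 else 1)
SG-[l,m,n] {n = 1} (s≤s ()) _ _
SG-[l,m,n] {suc (suc l)} {suc (suc m)} {2} _ n<m@(s≤s 1<1+m) (s≤s m<l)
  with even m | SG-[m,n] z<s n<m | SG-[l,m,1] {1 + l} {1 + m} 1<1+m m<l
... | true  | top | left = SG-moves (2 + l) (2 + m ∷ 2 ∷ []) top left
... | false | top | left = SG-moves (2 + l) (2 + m ∷ 2 ∷ []) top left
SG-[l,m,n] {suc (suc l)} {suc (suc m)} {suc (suc (suc n))} _ n<m@(s≤s n<m′) (s≤s m<l)
  with even n | SG-[m,n] z<s n<m | SG-[l,m,n] {1 + l} {1 + m} {2 + n} (s≤s (s≤s z≤n)) n<m′ m<l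
... | true  | top | left = SG-moves (2 + l) (2 + m ∷ 3 + n ∷ []) top left
... | false | top | left = SG-moves (2 + l) (2 + m ∷ 3 + n ∷ []) top left

lemma5p3 : (l₁ l₂ l₃ : ℕ) → l₂ ≤ l₁ → l₃ ≤ l₂ → 0 < l₃ →
  ((l₁ ≡ l₂ → l₂ ≡ l₃ →
      ((l₃ ≥ 3 → Odd l₃ → SG (L (l₁ ∷ l₂ ∷ l₃ ∷ [])) ≡ 0)
      × ((l₃ ≡ 1 ⊎ (l₃ ≥ 4 × Even l₃)) → SG (L (l₁ ∷ l₂ ∷ l₃ ∷ [])) ≡ 1)
      × (l₃ ≡ 2 → SG (L (l₁ ∷ l₂ ∷ l₃ ∷ [])) ≡ 2)))
  × (l₁ > l₂ → l₂ ≡ l₃ →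
      ((Odd l₃ → SG (L (l₁ ∷ l₂ ∷ l₃ ∷ [])) ≡ 0)
      × (Even l₃ → SG (L (l₁ ∷ l₂ ∷ l₃ ∷ [])) ≡ 1)))
  × (l₁ ≡ l₂ → l₂ > l₃ →
      ((Even l₃ → SG (L (l₁ ∷ l₂ ∷ l₃ ∷ [])) ≡ 0)
      × (Odd l₃ → SG (L (l₁ ∷ l₂ ∷ l₃ ∷ [])) ≡ 1)))
  × (l₁ > l₂ → l₂ > l₃ → l₃ ≡ 1 →
      ((Even l₂ → SG (L (l₁ ∷ l₂ ∷ l₃ ∷ [])) ≡ 1)
      × (Odd l₂ → SG (L (l₁ ∷ l₂ ∷ l₃ ∷ [])) ≡ 2)))
  × (l₁ > l₂ → l₂ > l₃ → l₃ > 1 →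
      ((Even l₃ → SG (L (l₁ ∷ l₂ ∷ l₃ ∷ [])) ≡ 0)
      × (Odd l₃ → SG (L (l₁ ∷ l₂ ∷ l₃ ∷ [])) ≡ 1))))
lemma5p3 l₁ l₂ l₃ _ _ 0<l₃ =
    (λ { refl refl →
           (λ 3≤l₃ → proj₂ (parity-cases (SG-[n,n,n] 3≤l₃)))
         , (λ { (inj₁ refl) → refl
              ; (inj₂ (4≤l₃ , 2∣l₃)) → proj₁ (parity-cases (SG-[n,n,n] (<⇒≤ 4≤l₃))) 2∣l₃ })
         , (λ { refl → refl }) })
  , (λ { l₂<l₁ refl → swap (parity-cases (SG-[m,n,n] 0<l₃ l₂<l₁)) })
  , (λ { refl l₃<l₂ → parity-cases (SG-[m,m,n] 0<l₃ l₃<l₂) })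
  , (λ { l₂<l₁ l₃<l₂ refl → parity-cases (SG-[l,m,1] l₃<l₂ l₂<l₁) })
  , (λ l₂<l₁ l₃<l₂ 1<l₃ → parity-cases (SG-[l,m,n] 1<l₃ l₃<l₂ l₂<l₁))
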